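{- Let $n$ be a positive multiple of $3$, let $\Pi$ be a $3$-decomposable halfperiod on $n$ points with classes $A,B,C$, and let $k$ be a positive integer with $k<n/2$. Then the number $N^{bi}_{\le k}(\Pi)$ of bichromatic $(\le k)$-critical transpositions of $\Pi$ equals \[ N^{bi}_{\le k}(\Pi)=\begin{cases}3\binom{k+1}{2} & \text{if } k\le n/3,\\[2pt] 3\binom{n/3+1}{2}+(k-n/3)n & \text{if } n/3<k<n/2.\end{cases} \]
   Context: A halfperiod on $n$ points is a sequence $\Pi=(\pi_0,\dots,\pi_{\binom n2})$ of permutations of an $n$-element set such that consecutive permutations differ by a transposition of two elements in adjacent positions and $\pi_{\binom n2}$ is the reverse of $\pi_0$ (each pair is transposed exactly once). A transposition of the elements in positions $i,i+1$ is an $i$-transposition; for $i\le n/2$ it is $i$-critical if it is an $i$- or $(n-i)$-transposition; it is $(\le k)$-critical if it is $i$-critical for some $i\le k$. $\Pi$ is $3$-decomposable if its elements can be labeled $A=\{a_1,\dots,a_{n/3}\}$, $B=\{b_1,\dots,b_{n/3}\}$, $C=\{c_1,\dots,c_{n/3}\}$ so that $\pi_0=(a_1,\dots,a_{n/3},b_1,\dots,b_{n/3},c_1,\dots,c_{n/3})$ and for some $0<s<t\le\binom n2$, $\pi_{s+1}$ lists all of $B$, then all of $A$, then all of $C$, and $\pi_{t+1}$ lists all of $B$, then all of $C$, then all of $A$. A transposition is monochromatic if both elements lie in the same class among $A,B,C$, and bichromatic otherwise. -}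

module Defs where

open import Data.Nat using (ℕ; zero; suc; _+_; _*_; _∸_; _≤_; _<_; NonZero; _≡ᵇ_)
open import Data.Nat.DivMod using (_/_)
open import Data.Nat.Combinatorics using (_C_)
open import Data.Bool using (Bool; true; false; _∧_; _∨_; not; if_then_else_)
open import Data.List using (List; upTo; map)
open import Data.Bool.ListAction using (any)
open import Data.Nat.ListAction using (sum)
open import Data.Fin using (Fin; toℕ; opposite)
open import Data.Fin.Permutation using (Permutation′; _⟨$⟩ʳ_; _⟨$⟩ˡ_; transpose)
open import Data.Product using (Σ; _×_; ∃-syntax)
open import Relation.Binary.PropositionalEquality using (_≡_)

-- A permutation π lists the points: π ⟨$⟩ʳ p is the
-- point at position p (positions 0-indexed).
-- A halfperiod on n points: permutations π 0 , … , π (n C 2)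
-- (values of π beyond n C 2 are irrelevant), where step j (j < n C 2)
-- swaps the points in the adjacent positions lo j , hi j = lo j + 1.
record Halfperiod (n : ℕ) : Set where
  field
    π    : ℕ → Permutation′ n
    lo   : ℕ → Fin n
    hi   : ℕ → Fin n
    adj  : ∀ j → j < n C 2 → toℕ (hi j) ≡ suc (toℕ (lo j))
    step : ∀ j → j < n C 2 → ∀ p →
           π (suc j) ⟨$⟩ʳ p ≡ π j ⟨$⟩ʳ (transpose (lo j) (hi j) ⟨$⟩ʳ p)
    rev  : ∀ p → π (n C 2) ⟨$⟩ʳ p ≡ π 0 ⟨$⟩ʳ opposite p

open Halfperiod public

-- Throughout n = 3 * m.  The classes are forced by π 0:
-- class 0 = A (first m positions of π 0), 1 = B, 2 = C.
module _ (m : ℕ) .{{_ : NonZero m}} (H : Halfperiod (3 * m)) where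

  cls : Fin (3 * m) → ℕ
  cls e = toℕ (π H 0 ⟨$⟩ˡ e) / m

  block : Fin (3 * m) → ℕ
  block p = toℕ p / m

  listsBAC : Permutation′ (3 * m) → Set
  listsBAC σ = ∀ p → cls (σ ⟨$⟩ʳ p) ≡ bac (block p)
    where
    bac : ℕ → ℕ
    bac 0 = 1
    bac 1 = 0
    bac _ = 2

  listsBCA : Permutation′ (3 * m) → Set
  listsBCA σ = ∀ p → cls (σ ⟨$⟩ʳ p) ≡ bca (block p)
    where
    bca : ℕ → ℕ
    bca 0 = 1
    bca 1 = 2
    bca _ = 0

  -- 3-decomposable (with classes A,B,C determined by π 0 as above).
  -- π (t+1) must exist, i.e. t + 1 ≤ n C 2.
  ThreeDecomposable : Set
  ThreeDecomposable =
    ∃[ s ] ∃[ t ] (0 < s × s < t × t ≤ (3 * m) C 2 × suc t ≤ (3 * m) C 2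
                   × listsBAC (π H (suc s)) × listsBCA (π H (suc t)))

  -- step j is an i-transposition iff it swaps 1-indexed positions i, i+1,
  -- i.e. suc (toℕ (lo j)) ≡ i.  (≤ k)-critical: i- or (n-i)-transposition
  -- for some 1 ≤ i ≤ k.
  critical≤ : ℕ → ℕ → Bool
  critical≤ k j = any (λ i → (suc (toℕ (lo H j)) ≡ᵇ suc i)
                           ∨ (suc (toℕ (lo H j)) ≡ᵇ (3 * m) ∸ suc i)) (upTo k)

  bichromatic : ℕ → Bool
  bichromatic j = not (cls (π H j ⟨$⟩ʳ lo H j) ≡ᵇ cls (π H j ⟨$⟩ʳ hi H j))

  Nbi≤ : ℕ → ℕ
  Nbi≤ k = sum (map (λ j → if critical≤ k j ∧ bichromatic j then 1 else 0)
                    (upTo ((3 * m) C 2)))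

-- Each adjacent transposition changes the number of inversions relative to π 0 by one, and
-- π (n C 2) has n C 2 of them, so every transposition moves the point that comes earlier in
-- π 0 to the right; in particular a pair, once inverted, stays inverted.  Let t + 1 be the
-- time of the order B, C, A.  Before it no B passes a C and after it no A passes a B, so a
-- bichromatic transposition at gap b moves an A out of positions 0 … b if it happens before
-- t + 1, and a C into them afterwards.  Summing over the (≤ k)-critical gaps b the number of
-- A's (resp. C's) among positions 0 … b therefore gives a potential that drops (resp. grows)
-- by exactly the counted transpositions.  Its values at times 0, t + 1 and n C 2 give
--   Nbi≤ k + Σ (b + 1) = 3 Σ min (b + 1, n / 3)
-- with both sums over the critical gaps, and the two sums are evaluated directly.

module Submission where

open import Defs
open import Data.Nat
  using (ℕ; zero; suc; pred; _+_; _*_; _∸_; _⊓_; _≤_; _<_; _≡ᵇ_; _<ᵇ_; NonZero; z≤n; s≤s; z<s; s<s; s≤s⁻¹; s<s⁻¹)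
open import Data.Nat.Properties
open import Data.Nat.Combinatorics using (_C_; nC1≡n; nCk+nC[k+1]≡[n+1]C[k+1])
open import Data.Nat.ListAction using (sum)
open import Data.Nat.Tactic.RingSolver using (solve-∀)
open import Data.Bool using (Bool; true; false; if_then_else_; _∧_; _∨_; not; T)
open import Data.List using (map; applyUpTo; upTo)
open import Data.Bool.ListAction using (any)
open import Data.Bool.Properties using (T-≡; ¬-not; ∨-zeroʳ)
open import Data.List.Membership.Propositional using (lose; find)
open import Data.List.Membership.Propositional.Properties using (∈-upTo⁺; ∈-upTo⁻)
open import Data.List.Relation.Unary.Any.Properties using (any⁺; any⁻)
open import Function.Bundles using (Equivalence)
open import Data.Product using (_×_; _,_; proj₁; proj₂; ∃-syntax)
open import Data.Sum using (inj₁; inj₂)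
open import Data.Fin as Fin using (Fin; toℕ)
open import Data.Fin.Properties using (toℕ-injective; toℕ-fromℕ<; toℕ<n; opposite-prop)
open import Data.Fin.Permutation using (_⟨$⟩ʳ_; _⟨$⟩ˡ_; transpose; inverseˡ; inverseʳ)
open import Data.Nat.DivMod
open import Function using (_∘_)
open import Relation.Nullary using (¬_; yes; no; contradiction)
open import Relation.Nullary.Decidable using (dec-true; dec-false)
open import Relation.Binary.PropositionalEquality
open import Algebra.Properties.CommutativeSemigroup +-commutativeSemigroup
  using (interchange; xy∙z≈xz∙y; xy∙z≈x∙zy)

-- Finite sums

𝟙 : Bool → ℕ
𝟙 b = if b then 1 else 0

𝟙≤1 : ∀ b → 𝟙 b ≤ 1
𝟙≤1 true  = ≤-refl
𝟙≤1 false = z≤n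

∑< : ℕ → (ℕ → ℕ) → ℕ
∑< zero    f = 0
∑< (suc k) f = ∑< k f + f k

syntax ∑< k (λ i → e) = ∑[ i < k ] e

∑-cong : ∀ {f g} k → (∀ i → i < k → f i ≡ g i) → ∑< k f ≡ ∑< k g
∑-cong zero    f≡g = refl
∑-cong (suc k) f≡g = cong₂ _+_ (∑-cong k (λ i i<k → f≡g i (m<n⇒m<1+n i<k))) (f≡g k ≤-refl)

∑-shift : ∀ f k → ∑< (suc k) f ≡ f 0 + ∑[ i < k ] f (suc i)
∑-shift f zero    = +-comm 0 (f 0)
∑-shift f (suc k) = trans (cong (_+ f (suc k)) (∑-shift f k)) (+-assoc (f 0) _ _)

∑-+ : ∀ f g k → ∑[ i < k ] (f i + g i) ≡ ∑< k f + ∑< k g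
∑-+ f g zero    = refl
∑-+ f g (suc k) = trans (cong (_+ (f k + g k)) (∑-+ f g k)) (interchange (∑< k f) (∑< k g) (f k) (g k))

∑-split : ∀ f a b → ∑< (a + b) f ≡ ∑< a f + ∑[ i < b ] f (a + i)
∑-split f a zero    = trans (cong (λ c → ∑< c f) (+-identityʳ a)) (sym (+-identityʳ _))
∑-split f a (suc b) = begin
  ∑< (a + suc b) f                            ≡⟨ cong (λ c → ∑< c f) (+-suc a b) ⟩
  ∑< (a + b) f + f (a + b)                    ≡⟨ cong (_+ f (a + b)) (∑-split f a b) ⟩
  ∑< a f + ∑[ i < b ] f (a + i) + f (a + b)   ≡⟨ +-assoc (∑< a f) _ _ ⟩
  ∑< a f + ∑[ i < suc b ] f (a + i)           ∎
  where open ≡-Reasoning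

∑-const : ∀ c k → ∑[ _ < k ] c ≡ k * c
∑-const c zero    = refl
∑-const c (suc k) = trans (cong (_+ c) (∑-const c k)) (+-comm (k * c) c)

sum-applyUpTo : ∀ {A : Set} (f : A → ℕ) g k → sum (map f (applyUpTo g k)) ≡ ∑[ i < k ] f (g i)
sum-applyUpTo f g zero    = refl
sum-applyUpTo f g (suc k) =
  trans (cong (f (g 0) +_) (sum-applyUpTo f (g ∘ suc) k)) (sym (∑-shift (f ∘ g) k))

k+kC2≡[1+k]C2 : ∀ k → k + k C 2 ≡ suc k C 2
k+kC2≡[1+k]C2 k = trans (cong (_+ k C 2) (sym (nC1≡n k))) (nCk+nC[k+1]≡[n+1]C[k+1] k 1)

∑-id : ∀ k → ∑[ i < k ] i ≡ k C 2
∑-id zero    = refl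
∑-id (suc k) = trans (cong (_+ k) (∑-id k)) (trans (+-comm (k C 2) k) (k+kC2≡[1+k]C2 k))

∑-suc : ∀ k → ∑[ i < k ] suc i ≡ suc k C 2
∑-suc k = trans (sym (∑-shift (λ i → i) k)) (∑-id (suc k))

∑-id+∑-suc : ∀ k → ∑[ i < k ] i + ∑[ i < k ] suc i ≡ k * k
∑-id+∑-suc zero    = refl
∑-id+∑-suc (suc k) = begin
  (∑[ i < k ] i + k) + (∑[ i < k ] suc i + suc k)  ≡⟨ regroup (∑[ i < k ] i) (∑[ i < k ] suc i) k ⟩
  (∑[ i < k ] i + ∑[ i < k ] suc i) + k + suc k    ≡⟨ cong (λ s → s + k + suc k) (∑-id+∑-suc k) ⟩
  k * k + k + suc k                                ≡⟨ square-suc k ⟩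
  suc k * suc k                                    ∎
  where
  open ≡-Reasoning
  regroup : ∀ a b k → (a + k) + (b + suc k) ≡ (a + b) + k + suc k
  regroup = solve-∀
  square-suc : ∀ k → k * k + k + suc k ≡ suc k * suc k
  square-suc = solve-∀

∑-<ᵇ : ∀ m x → ∑[ i < x ] 𝟙 (i <ᵇ m) ≡ x ⊓ m
∑-<ᵇ m zero    = refl
∑-<ᵇ m (suc x) with x <? m
... | yes x<m = begin
  ∑[ i < x ] 𝟙 (i <ᵇ m) + 𝟙 (x <ᵇ m)  ≡⟨ cong₂ _+_ (∑-<ᵇ m x) (cong 𝟙 (dec-true (x <? m) x<m)) ⟩
  x ⊓ m + 1                          ≡⟨ cong (_+ 1) (m≤n⇒m⊓n≡m (<⇒≤ x<m)) ⟩
  x + 1                              ≡⟨ +-comm x 1 ⟩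
  suc x                              ≡⟨ m≤n⇒m⊓n≡m x<m ⟨
  suc x ⊓ m                          ∎
  where open ≡-Reasoning
... | no x≮m = begin
  ∑[ i < x ] 𝟙 (i <ᵇ m) + 𝟙 (x <ᵇ m)  ≡⟨ cong₂ _+_ (∑-<ᵇ m x) (cong 𝟙 (dec-false (x <? m) x≮m)) ⟩
  x ⊓ m + 0                          ≡⟨ +-identityʳ _ ⟩
  x ⊓ m                              ≡⟨ m≥n⇒m⊓n≡n (≮⇒≥ x≮m) ⟩
  m                                  ≡⟨ m≥n⇒m⊓n≡n (m≤n⇒m≤1+n (≮⇒≥ x≮m)) ⟨
  suc x ⊓ m                          ∎
  where open ≡-Reasoning

∑-⊓-below : ∀ m k → k ≤ m → ∑[ b < k ] (suc b ⊓ m) ≡ suc k C 2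
∑-⊓-below m k k≤m = trans (∑-cong k (λ b b<k → m≤n⇒m⊓n≡m (≤-trans b<k k≤m))) (∑-suc k)

∑-⊓-above : ∀ m k → m ≤ k → ∑[ b < k ] (suc b ⊓ m) ≡ suc m C 2 + (k ∸ m) * m
∑-⊓-above m k m≤k = begin
  ∑[ b < k ] (suc b ⊓ m)                                       ≡⟨ cong (λ x → ∑[ b < x ] (suc b ⊓ m)) (m+[n∸m]≡n m≤k) ⟨
  ∑[ b < m + (k ∸ m) ] (suc b ⊓ m)                             ≡⟨ ∑-split _ m (k ∸ m) ⟩
  ∑[ b < m ] (suc b ⊓ m) + ∑[ i < k ∸ m ] (suc (m + i) ⊓ m)    ≡⟨ cong₂ _+_ (∑-⊓-below m m ≤-refl)
                                                                   (∑-cong (k ∸ m) (λ i _ → m≥n⇒m⊓n≡n (m≤n⇒m≤1+n (m≤m+n m i)))) ⟩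
  suc m C 2 + ∑[ _ < k ∸ m ] m                                 ≡⟨ cong (suc m C 2 +_) (∑-const m (k ∸ m)) ⟩
  suc m C 2 + (k ∸ m) * m                                      ∎
  where open ≡-Reasoning

∑-update : ∀ f f′ K l d e → l < K → (∀ b → b < K → b ≢ l → f′ b ≡ f b) →
           f′ l + d ≡ f l + e → ∑< K f′ + d ≡ ∑< K f + e
∑-update f f′ (suc K) l d e l<1+K f′≡f at-l with l ≟ K
... | yes refl = begin
  ∑< l f′ + f′ l + d    ≡⟨ +-assoc (∑< l f′) _ _ ⟩
  ∑< l f′ + (f′ l + d)  ≡⟨ cong₂ _+_ (∑-cong l (λ b b<l → f′≡f b (m<n⇒m<1+n b<l) (<⇒≢ b<l))) at-l ⟩
  ∑< l f + (f l + e)    ≡⟨ +-assoc (∑< l f) _ _ ⟨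
  ∑< l f + f l + e      ∎
  where open ≡-Reasoning
... | no l≢K = begin
  ∑< K f′ + f′ K + d    ≡⟨ cong (λ x → ∑< K f′ + x + d) (f′≡f K ≤-refl (l≢K ∘ sym)) ⟩
  ∑< K f′ + f K + d     ≡⟨ xy∙z≈xz∙y (∑< K f′) (f K) d ⟩
  ∑< K f′ + d + f K     ≡⟨ cong (_+ f K) (∑-update f f′ K l d e l<K (λ b b<K → f′≡f b (m<n⇒m<1+n b<K)) at-l) ⟩
  ∑< K f + e + f K      ≡⟨ xy∙z≈xz∙y (∑< K f) e (f K) ⟩
  ∑< K f + f K + e      ∎
  where
  open ≡-Reasoning
  l<K : l < K
  l<K = ≤∧≢⇒< (s≤s⁻¹ l<1+K) l≢K

telescope-down : ∀ (P X : ℕ → ℕ) d → (∀ j → j < d → P (suc j) + X j ≡ P j) → ∑< d X + P d ≡ P 0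
telescope-down P X zero    _    = refl
telescope-down P X (suc d) step = begin
  ∑< d X + X d + P (suc d)    ≡⟨ xy∙z≈x∙zy (∑< d X) (X d) (P (suc d)) ⟩
  ∑< d X + (P (suc d) + X d)  ≡⟨ cong (∑< d X +_) (step d ≤-refl) ⟩
  ∑< d X + P d                ≡⟨ telescope-down P X d (λ j j<d → step j (m<n⇒m<1+n j<d)) ⟩
  P 0                         ∎
  where open ≡-Reasoning

telescope-up : ∀ (P X : ℕ → ℕ) a d → (∀ j → j < d → P (suc (a + j)) ≡ P (a + j) + X (a + j)) →
  P a + ∑[ j < d ] X (a + j) ≡ P (a + d)
telescope-up P X a zero    _    = trans (+-identityʳ (P a)) (cong P (sym (+-identityʳ a)))
telescope-up P X a (suc d) step = begin
  P a + (∑[ j < d ] X (a + j) + X (a + d))  ≡⟨ +-assoc (P a) _ _ ⟨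
  P a + ∑[ j < d ] X (a + j) + X (a + d)    ≡⟨ cong (_+ X (a + d)) (telescope-up P X a d (λ j j<d → step j (m<n⇒m<1+n j<d))) ⟩
  P (a + d) + X (a + d)                     ≡⟨ step d ≤-refl ⟨
  P (suc (a + d))                           ≡⟨ cong P (+-suc a d) ⟨
  P (a + suc d)                             ∎
  where open ≡-Reasoning

3*[a+d*m]≡3*a+d*[3*m] : ∀ a d m → 3 * (a + d * m) ≡ 3 * a + d * (3 * m)
3*[a+d*m]≡3*a+d*[3*m] = solve-∀

telescope-halves : ∀ {x s₁ s₂ a c w v} → x ≡ s₁ + s₂ → s₁ + a ≡ w → c + s₂ ≡ w → a + c + w ≡ v →
  x + v ≡ 3 * w
telescope-halves {x} {s₁} {s₂} {a} {c} {w} {v} x≡ first second middle = begin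
  x + v                        ≡⟨ cong₂ _+_ x≡ (sym middle) ⟩
  s₁ + s₂ + (a + c + w)        ≡⟨ regroup s₁ s₂ a c w ⟩
  (s₁ + a) + (c + s₂) + w      ≡⟨ cong₂ (λ y z → y + z + w) first second ⟩
  w + w + w                    ≡⟨ triple w ⟩
  3 * w                        ∎
  where
  open ≡-Reasoning
  regroup : ∀ s₁ s₂ a c w → s₁ + s₂ + (a + c + w) ≡ (s₁ + a) + (c + s₂) + w
  regroup = solve-∀
  triple : ∀ w → w + w + w ≡ 3 * w
  triple = solve-∀

gate : Bool → ℕ → ℕ
gate w a = if w then a else 0

gate-+ : ∀ w a b → gate w a + gate w b ≡ gate w (a + b)
gate-+ false a b = refl
gate-+ true  a b = refl

gate-𝟙 : ∀ w b a → gate w a + 𝟙 (w ∧ b) ≡ gate w (a + 𝟙 b)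
gate-𝟙 false b a = refl
gate-𝟙 true  b a = refl

-- Adjacent transpositions and inversions

swapAt : ℕ → ℕ → ℕ
swapAt zero    zero          = 1
swapAt zero    (suc zero)    = 0
swapAt zero    (suc (suc i)) = suc (suc i)
swapAt (suc l) zero          = zero
swapAt (suc l) (suc i)       = suc (swapAt l i)

swapAt-left : ∀ l → swapAt l l ≡ suc l
swapAt-left zero    = refl
swapAt-left (suc l) = cong suc (swapAt-left l)

swapAt-right : ∀ l → swapAt l (suc l) ≡ l
swapAt-right zero    = refl
swapAt-right (suc l) = cong suc (swapAt-right l)

swapAt-fixes : ∀ l i → i ≢ l → i ≢ suc l → swapAt l i ≡ i
swapAt-fixes zero    zero          i≢l _    = contradiction refl i≢l
swapAt-fixes zero    (suc zero)    _   i≢1+l = contradiction refl i≢1+l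
swapAt-fixes zero    (suc (suc i)) _   _    = refl
swapAt-fixes (suc l) zero          _   _    = refl
swapAt-fixes (suc l) (suc i)       i≢l i≢1+l =
  cong suc (swapAt-fixes l i (i≢l ∘ cong suc) (i≢1+l ∘ cong suc))

swapAt-involutive : ∀ l i → swapAt l (swapAt l i) ≡ i
swapAt-involutive zero    zero          = refl
swapAt-involutive zero    (suc zero)    = refl
swapAt-involutive zero    (suc (suc i)) = refl
swapAt-involutive (suc l) zero          = refl
swapAt-involutive (suc l) (suc i)       = cong suc (swapAt-involutive l i)

swapAt-< : ∀ l i k → suc l < k → i < k → swapAt l i < k
swapAt-< zero    zero          k       1<k _       = 1<k
swapAt-< zero    (suc zero)    (suc k) _   _       = z<s
swapAt-< zero    (suc (suc i)) k       _   i<k     = i<k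
swapAt-< (suc l) zero          (suc k) _   _       = z<s
swapAt-< (suc l) (suc i)       (suc k) 2+l<1+k 1+i<1+k =
  s<s (swapAt-< l i k (s<s⁻¹ 2+l<1+k) (s<s⁻¹ 1+i<1+k))

swapAt-monotone : ∀ l i j → i < j → ¬ (i ≡ l × j ≡ suc l) → swapAt l i < swapAt l j
swapAt-monotone zero    zero          (suc zero)    _   ¬adj = contradiction (refl , refl) ¬adj
swapAt-monotone zero    zero          (suc (suc j)) _   _    = s<s z<s
swapAt-monotone zero    (suc zero)    (suc (suc j)) _   _    = z<s
swapAt-monotone zero    (suc (suc i)) (suc (suc j)) i<j _    = i<j
swapAt-monotone zero    (suc zero)    (suc zero)    i<j _    = contradiction i<j (<-irrefl refl)
swapAt-monotone zero    (suc (suc i)) (suc zero)    (s<s ()) _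
swapAt-monotone (suc l) zero          (suc j)       _   _    = z<s
swapAt-monotone (suc l) (suc i)       (suc j)       i<j ¬adj =
  s<s (swapAt-monotone l i j (s<s⁻¹ i<j) (λ (i≡l , j≡1+l) → ¬adj (cong suc i≡l , cong suc j≡1+l)))

∑-swapAt-adjacent : ∀ g l → ∑[ i < suc l ] g (swapAt l i) + g l ≡ ∑< (suc l) g + g (suc l)
∑-swapAt-adjacent g l = begin
  ∑[ i < l ] g (swapAt l i) + g (swapAt l l) + g l  ≡⟨ cong₂ (λ s x → s + x + g l) below (cong g (swapAt-left l)) ⟩
  ∑< l g + g (suc l) + g l                           ≡⟨ xy∙z≈xz∙y (∑< l g) (g (suc l)) (g l) ⟩
  ∑< l g + g l + g (suc l)                           ∎
  where
  open ≡-Reasoning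
  below : ∑[ i < l ] g (swapAt l i) ≡ ∑< l g
  below = ∑-cong l (λ i i<l → cong g (swapAt-fixes l i (<⇒≢ i<l) (<⇒≢ (m<n⇒m<1+n i<l))))

∑-swapAt : ∀ g l k → k ≢ suc l → ∑[ i < k ] g (swapAt l i) ≡ ∑< k g
∑-swapAt g l zero    _ = refl
∑-swapAt g l (suc k) 1+k≢1+l with k ≟ suc l
... | yes refl = trans (cong (∑[ i < suc l ] g (swapAt l i) +_) (cong g (swapAt-right l))) (∑-swapAt-adjacent g l)
... | no k≢1+l = cong₂ _+_ (∑-swapAt g l k k≢1+l) (cong g (swapAt-fixes l k (1+k≢1+l ∘ cong suc) k≢1+l))

inversions : (ℕ → ℕ) → ℕ → ℕ
inversions g zero    = 0
inversions g (suc k) = ∑[ i < k ] 𝟙 (g (suc i) <ᵇ g 0) + inversions (g ∘ suc) k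

inversions-cong : ∀ {g g′} k → (∀ i → i < k → g i ≡ g′ i) → inversions g k ≡ inversions g′ k
inversions-cong zero    _    = refl
inversions-cong (suc k) g≡g′ = cong₂ _+_
  (∑-cong k (λ i i<k → cong₂ (λ x y → 𝟙 (x <ᵇ y)) (g≡g′ (suc i) (s<s i<k)) (g≡g′ 0 z<s)))
  (inversions-cong k (λ i i<k → g≡g′ (suc i) (s<s i<k)))

inversions-swapAt : ∀ g l k → suc l < k →
  inversions (g ∘ swapAt l) k + 𝟙 (g (suc l) <ᵇ g l) ≡ inversions g k + 𝟙 (g l <ᵇ g (suc l))
inversions-swapAt g zero (suc (suc k)) _ = begin
  (∑< (suc k) F′ + (B₀ + I)) + A′  ≡⟨ cong (λ s → (s + (B₀ + I)) + A′) (∑-shift F′ k) ⟩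
  ((A + B₁) + (B₀ + I)) + A′       ≡⟨ regroup A B₁ B₀ I A′ ⟩
  ((A′ + B₀) + (B₁ + I)) + A       ≡⟨ cong (λ s → (s + (B₁ + I)) + A) (∑-shift F k) ⟨
  (∑< (suc k) F + (B₁ + I)) + A    ∎
  where
  open ≡-Reasoning
  F F′ : ℕ → ℕ
  F  i = 𝟙 (g (suc i) <ᵇ g 0)
  F′ i = 𝟙 (g (swapAt 0 (suc i)) <ᵇ g 1)
  A A′ B₀ B₁ I : ℕ
  A  = 𝟙 (g 0 <ᵇ g 1)
  A′ = 𝟙 (g 1 <ᵇ g 0)
  B₀ = ∑[ i < k ] 𝟙 (g (suc (suc i)) <ᵇ g 0)
  B₁ = ∑[ i < k ] 𝟙 (g (suc (suc i)) <ᵇ g 1)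
  I  = inversions (g ∘ suc ∘ suc) k
  regroup : ∀ a b₁ b₀ i a′ → ((a + b₁) + (b₀ + i)) + a′ ≡ ((a′ + b₀) + (b₁ + i)) + a
  regroup = solve-∀
inversions-swapAt g zero    (suc zero) (s<s ())
inversions-swapAt g (suc l) (suc k) 2+l<1+k = begin
  (B′ + inversions (g ∘ suc ∘ swapAt l) k) + A′  ≡⟨ +-assoc B′ _ A′ ⟩
  B′ + (inversions (g ∘ suc ∘ swapAt l) k + A′)  ≡⟨ cong₂ _+_ (∑-swapAt (λ i → 𝟙 (g (suc i) <ᵇ g 0)) l k (>⇒≢ 1+l<k))
                                                             (inversions-swapAt (g ∘ suc) l k 1+l<k) ⟩
  B + (inversions (g ∘ suc) k + A)                ≡⟨ +-assoc B _ A ⟨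
  (B + inversions (g ∘ suc) k) + A                ∎
  where
  open ≡-Reasoning
  1+l<k : suc l < k
  1+l<k = s<s⁻¹ 2+l<1+k
  A A′ B B′ : ℕ
  A  = 𝟙 (g (suc l) <ᵇ g (suc (suc l)))
  A′ = 𝟙 (g (suc (suc l)) <ᵇ g (suc l))
  B  = ∑[ i < k ] 𝟙 (g (suc i) <ᵇ g 0)
  B′ = ∑[ i < k ] 𝟙 (g (suc (swapAt l i)) <ᵇ g 0)

inversions-increasing : ∀ g k → (∀ i j → i < j → j < k → g i < g j) → inversions g k ≡ 0
inversions-increasing g zero    _   = refl
inversions-increasing g (suc k) inc = cong₂ _+_ none
  (inversions-increasing (g ∘ suc) k (λ i j i<j j<k → inc (suc i) (suc j) (s<s i<j) (s<s j<k)))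
  where
  none : ∑[ i < k ] 𝟙 (g (suc i) <ᵇ g 0) ≡ 0
  none = trans (∑-cong k (λ i i<k → cong 𝟙 (dec-false (g (suc i) <? g 0) (<⇒≯ (inc 0 (suc i) z<s (s<s i<k))))))
               (trans (∑-const 0 k) (*-zeroʳ k))

inversions-decreasing : ∀ g k → (∀ i j → i < j → j < k → g j < g i) → inversions g k ≡ k C 2
inversions-decreasing g zero    _   = refl
inversions-decreasing g (suc k) dec = trans (cong₂ _+_ all
  (inversions-decreasing (g ∘ suc) k (λ i j i<j j<k → dec (suc i) (suc j) (s<s i<j) (s<s j<k))))
  (k+kC2≡[1+k]C2 k)
  where
  all : ∑[ i < k ] 𝟙 (g (suc i) <ᵇ g 0) ≡ k
  all = trans (∑-cong k (λ i i<k → cong 𝟙 (dec-true (g (suc i) <? g 0) (dec 0 (suc i) z<s (s<s i<k)))))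
              (trans (∑-const 1 k) (*-identityʳ k))

module AdjacentSorting {n N : ℕ} (g : ℕ → ℕ → ℕ) (L : ℕ → ℕ)
  (1+L<n : ∀ j → j < N → suc (L j) < n)
  (g-step : ∀ j → j < N → ∀ i → i < n → g (suc j) i ≡ g j (swapAt (L j) i)) where

  inversions-step : ∀ j → j < N →
    inversions (g (suc j)) n + 𝟙 (g j (suc (L j)) <ᵇ g j (L j))
      ≡ inversions (g j) n + 𝟙 (g j (L j) <ᵇ g j (suc (L j)))
  inversions-step j j<N = trans (cong (_+ _) (inversions-cong n (g-step j j<N)))
                                (inversions-swapAt (g j) (L j) n (1+L<n j j<N))

  inversions-suc : ∀ j → j < N → inversions (g (suc j)) n ≤ suc (inversions (g j) n)
  inversions-suc j j<N = begin
    inversions (g (suc j)) n                                     ≤⟨ m≤m+n _ _ ⟩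
    inversions (g (suc j)) n + 𝟙 (g j (suc (L j)) <ᵇ g j (L j))  ≡⟨ inversions-step j j<N ⟩
    inversions (g j) n + 𝟙 (g j (L j) <ᵇ g j (suc (L j)))        ≤⟨ +-monoʳ-≤ _ (𝟙≤1 _) ⟩
    inversions (g j) n + 1                                       ≡⟨ +-comm _ 1 ⟩
    suc (inversions (g j) n)                                     ∎
    where open ≤-Reasoning

  inversions-descent : ∀ j → j < N → ¬ (g j (L j) < g j (suc (L j))) →
    inversions (g (suc j)) n ≤ inversions (g j) n
  inversions-descent j j<N ¬asc = begin
    inversions (g (suc j)) n                                     ≤⟨ m≤m+n _ _ ⟩
    inversions (g (suc j)) n + 𝟙 (g j (suc (L j)) <ᵇ g j (L j))  ≡⟨ inversions-step j j<N ⟩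
    inversions (g j) n + 𝟙 (g j (L j) <ᵇ g j (suc (L j)))        ≡⟨ cong (λ b → inversions (g j) n + 𝟙 b) (dec-false (_ <? _) ¬asc) ⟩
    inversions (g j) n + 0                                       ≡⟨ +-identityʳ _ ⟩
    inversions (g j) n                                           ∎
    where open ≤-Reasoning

  inversions-growth : ∀ a d → a + d ≤ N → inversions (g (a + d)) n ≤ inversions (g a) n + d
  inversions-growth a zero    _       = ≤-reflexive (trans (cong (λ j → inversions (g j) n) (+-identityʳ a))
                                                           (sym (+-identityʳ _)))
  inversions-growth a (suc d) a+1+d≤N = begin
    inversions (g (a + suc d)) n    ≡⟨ cong (λ j → inversions (g j) n) (+-suc a d) ⟩
    inversions (g (suc (a + d))) n  ≤⟨ inversions-suc (a + d) a+d<N ⟩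
    suc (inversions (g (a + d)) n)  ≤⟨ s≤s (inversions-growth a d (<⇒≤ a+d<N)) ⟩
    suc (inversions (g a) n + d)    ≡⟨ +-suc _ d ⟨
    inversions (g a) n + suc d      ∎
    where
    open ≤-Reasoning
    a+d<N : a + d < N
    a+d<N = subst (_≤ N) (+-suc a d) a+1+d≤N

  every-step-ascends : inversions (g 0) n ≡ 0 → inversions (g N) n ≡ N →
    ∀ j → j < N → g j (L j) < g j (suc (L j))
  every-step-ascends inv-initial inv-final j j<N with g j (L j) <? g j (suc (L j))
  ... | yes asc = asc
  ... | no ¬asc = contradiction inv-final (<⇒≢ too-few)
    where
    open ≤-Reasoning
    d : ℕ
    d = N ∸ suc j
    1+j+d≡N : suc j + d ≡ N
    1+j+d≡N = m+[n∸m]≡n j<N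
    too-few : inversions (g N) n < N
    too-few = begin-strict
      inversions (g N) n            ≡⟨ cong (λ i → inversions (g i) n) 1+j+d≡N ⟨
      inversions (g (suc j + d)) n  ≤⟨ inversions-growth (suc j) d (≤-reflexive 1+j+d≡N) ⟩
      inversions (g (suc j)) n + d  ≤⟨ +-monoˡ-≤ d (inversions-descent j j<N ¬asc) ⟩
      inversions (g j) n + d        ≤⟨ +-monoˡ-≤ d (inversions-growth 0 j (<⇒≤ j<N)) ⟩
      inversions (g 0) n + j + d    ≡⟨ cong (λ i → i + j + d) inv-initial ⟩
      j + d                         <⟨ n<1+n _ ⟩
      suc j + d                     ≡⟨ 1+j+d≡N ⟩
      N                             ∎

-- Critical gaps

any-upTo-true : ∀ (p : ℕ → Bool) {k i} → i < k → p i ≡ true → any p (upTo k) ≡ true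
any-upTo-true p i<k pi≡true =
  Equivalence.to T-≡ (any⁺ p (lose (∈-upTo⁺ i<k) (Equivalence.from T-≡ pi≡true)))

any-upTo-false : ∀ (p : ℕ → Bool) k → (∀ i → i < k → p i ≡ false) → any p (upTo k) ≡ false
any-upTo-false p k none = ¬-not (λ any≡true →
  let (i , i∈upTo , pi) = find (any⁻ p (upTo k) (Equivalence.from T-≡ any≡true))
  in subst T (none i (∈-upTo⁻ i∈upTo)) pi)

criticalGap : ℕ → ℕ → ℕ → Bool
criticalGap n k b = any (λ i → (suc b ≡ᵇ suc i) ∨ (suc b ≡ᵇ n ∸ suc i)) (upTo k)

criticalSum : ℕ → ℕ → (ℕ → ℕ) → ℕ
criticalSum n k f = ∑[ b < pred n ] gate (criticalGap n k b) (f b)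

criticalGap-low : ∀ n k b → b < k → criticalGap n k b ≡ true
criticalGap-low n k b b<k =
  any-upTo-true _ b<k (cong (_∨ (suc b ≡ᵇ n ∸ suc b)) (dec-true (suc b ≟ suc b) refl))

criticalGap-middle : ∀ k r c → c < r → criticalGap (suc (k + (r + k))) k (k + c) ≡ false
criticalGap-middle k r c c<r = any-upTo-false _ k (λ i i<k → cong₂ _∨_
  (dec-false (suc (k + c) ≟ suc i) (λ eq → <⇒≱ i<k (≤-trans (m≤m+n k c) (≤-reflexive (suc-injective eq)))))
  (dec-false (suc (k + c) ≟ k + (r + k) ∸ i) (<⇒≢ (below-mirror i i<k))))
  where
  below-mirror : ∀ i → i < k → suc (k + c) < k + (r + k) ∸ i
  below-mirror i i<k = begin-strict
    suc (k + c)        ≤⟨ +-monoʳ-< k c<r ⟩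
    k + r              ≡⟨ m+n∸n≡m (k + r) k ⟨
    k + r + k ∸ k      ≡⟨ cong (_∸ k) (+-assoc k r k) ⟩
    k + (r + k) ∸ k    <⟨ ∸-monoʳ-< i<k (m≤m+n k (r + k)) ⟩
    k + (r + k) ∸ i    ∎
    where open ≤-Reasoning

criticalGap-high : ∀ k r c → c < k → criticalGap (suc (k + (r + k))) k (k + (r + c)) ≡ true
criticalGap-high k r c c<k = any-upTo-true _ i<k
  (trans (cong ((suc (k + (r + c)) ≡ᵇ suc i) ∨_) (dec-true (_ ≟ _) mirror)) (∨-zeroʳ _))
  where
  open ≡-Reasoning
  i : ℕ
  i = k ∸ suc c
  i<k : i < k
  i<k = ∸-monoʳ-< {o = 0} z<s c<k
  mirror : suc (k + (r + c)) ≡ k + (r + k) ∸ i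
  mirror = sym (begin
    k + (r + k) ∸ i            ≡⟨ cong (λ y → k + (r + y) ∸ i) (m∸n+n≡m c<k) ⟨
    k + (r + (i + suc c)) ∸ i  ≡⟨ cong (_∸ i) (shuffle k r i c) ⟩
    suc (k + (r + c)) + i ∸ i  ≡⟨ m+n∸n≡m _ i ⟩
    suc (k + (r + c))          ∎)
    where
    shuffle : ∀ k r i c → k + (r + (i + suc c)) ≡ suc (k + (r + c)) + i
    shuffle = solve-∀

∑-criticalGap : ∀ k r f → criticalSum (suc (k + (r + k))) k f ≡ ∑< k f + ∑[ c < k ] f (k + (r + c))
∑-criticalGap k r f = begin
  ∑< (k + (r + k)) F                                            ≡⟨ ∑-split F k (r + k) ⟩
  ∑< k F + ∑[ c < r + k ] F (k + c)                             ≡⟨ cong (∑< k F +_) (∑-split _ r k) ⟩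
  ∑< k F + (∑[ c < r ] F (k + c) + ∑[ c < k ] F (k + (r + c)))  ≡⟨ cong₂ (λ x y → x + (y + ∑[ c < k ] F (k + (r + c)))) low middle ⟩
  ∑< k f + (0 + ∑[ c < k ] F (k + (r + c)))                     ≡⟨ cong (∑< k f +_) high ⟩
  ∑< k f + ∑[ c < k ] f (k + (r + c))                           ∎
  where
  open ≡-Reasoning
  F : ℕ → ℕ
  F b = gate (criticalGap (suc (k + (r + k))) k b) (f b)
  low : ∑< k F ≡ ∑< k f
  low = ∑-cong k (λ b b<k → cong (λ w → gate w (f b)) (criticalGap-low (suc (k + (r + k))) k b b<k))
  middle : ∑[ c < r ] F (k + c) ≡ 0
  middle = trans (∑-cong r (λ c c<r → cong (λ w → gate w (f (k + c))) (criticalGap-middle k r c c<r)))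
                 (trans (∑-const 0 r) (*-zeroʳ r))
  high : ∑[ c < k ] F (k + (r + c)) ≡ ∑[ c < k ] f (k + (r + c))
  high = ∑-cong k (λ c c<k → cong (λ w → gate w (f (k + (r + c)))) (criticalGap-high k r c c<k))

gaps-decomposition : ∀ n k → 2 * k < n → ∃[ r ] n ≡ suc (k + (r + k))
gaps-decomposition n k 2k<n = n ∸ suc (2 * k) , trans (sym (m+[n∸m]≡n 2k<n)) (cong suc (regroup k (n ∸ suc (2 * k))))
  where
  regroup : ∀ k r → 2 * k + r ≡ k + (r + k)
  regroup = solve-∀

criticalSum-suc : ∀ k r → criticalSum (suc (k + (r + k))) k suc ≡ k * suc (k + (r + k))
criticalSum-suc k r = begin
  criticalSum (suc (k + (r + k))) k suc                       ≡⟨ ∑-criticalGap k r suc ⟩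
  ∑[ b < k ] suc b + ∑[ c < k ] suc (k + (r + c))              ≡⟨ cong (∑[ b < k ] suc b +_) upper ⟩
  ∑[ b < k ] suc b + (k * suc (k + r) + ∑[ c < k ] c)           ≡⟨ regroup (∑[ b < k ] suc b) (∑[ c < k ] c) (k * suc (k + r)) ⟩
  (∑[ c < k ] c + ∑[ b < k ] suc b) + k * suc (k + r)           ≡⟨ cong (_+ k * suc (k + r)) (∑-id+∑-suc k) ⟩
  k * k + k * suc (k + r)                                      ≡⟨ distribute k r ⟩
  k * suc (k + (r + k))                                        ∎
  where
  open ≡-Reasoning
  upper : ∑[ c < k ] suc (k + (r + c)) ≡ k * suc (k + r) + ∑[ c < k ] c
  upper = trans (∑-cong k (λ c _ → cong suc (sym (+-assoc k r c))))
                (trans (∑-+ (λ _ → suc (k + r)) (λ c → c) k) (cong (_+ ∑[ c < k ] c) (∑-const (suc (k + r)) k)))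
  regroup : ∀ s i p → s + (p + i) ≡ (i + s) + p
  regroup = solve-∀
  distribute : ∀ k r → k * k + k * suc (k + r) ≡ k * suc (k + (r + k))
  distribute = solve-∀

criticalSum-⊓ : ∀ k r m → m ≤ suc (k + r) →
  criticalSum (suc (k + (r + k))) k (λ b → suc b ⊓ m) ≡ ∑[ b < k ] (suc b ⊓ m) + k * m
criticalSum-⊓ k r m m≤1+k+r = trans (∑-criticalGap k r (λ b → suc b ⊓ m))
  (cong (∑[ b < k ] (suc b ⊓ m) +_) (trans (∑-cong k (λ c _ → m≥n⇒m⊓n≡n (≤-trans m≤1+k+r (s≤s beyond))))
                                              (∑-const m k)))
  where
  beyond : ∀ {c} → k + r ≤ k + (r + c)
  beyond {c} = +-monoʳ-≤ k (m≤m+n r c)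

3m≡gaps⇒m≤1+k+r : ∀ m k r → 3 * m ≡ suc (k + (r + k)) → 2 * k < 3 * m → m ≤ suc (k + r)
3m≡gaps⇒m≤1+k+r m k r 3m≡ 2k<3m with m ≤? suc (k + r)
... | yes m≤ = m≤
... | no m≰ = contradiction 3m<3m (<-irrefl refl)
  where
  open ≤-Reasoning
  p<m : suc (k + r) < m
  p<m = ≰⇒> m≰
  3m≡p+k : 3 * m ≡ suc (k + r) + k
  3m≡p+k = trans 3m≡ (cong suc (sym (+-assoc k r k)))
  k<m : k < m
  k<m = +-cancelʳ-< k k m (begin-strict
    k + k          ≡⟨ cong (k +_) (+-identityʳ k) ⟨
    2 * k          <⟨ 2k<3m ⟩
    3 * m          ≡⟨ 3m≡p+k ⟩
    suc (k + r) + k <⟨ +-monoˡ-< k p<m ⟩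
    m + k          ∎)
  3m<3m : 3 * m < 3 * m
  3m<3m = begin-strict
    3 * m          ≡⟨ 3m≡p+k ⟩
    suc (k + r) + k <⟨ +-monoˡ-< k p<m ⟩
    m + k          <⟨ +-monoʳ-< m k<m ⟩
    m + m          ≤⟨ +-monoʳ-≤ m (m≤m+n m (m + 0)) ⟩
    3 * m          ∎

-- Halfperiods

toℕ-transpose-adjacent : ∀ {n} (a b p : Fin n) → toℕ b ≡ suc (toℕ a) →
  toℕ (transpose a b ⟨$⟩ʳ p) ≡ swapAt (toℕ a) (toℕ p)
toℕ-transpose-adjacent a b p b≡1+a with p Fin.≟ a
... | yes refl = trans b≡1+a (sym (swapAt-left (toℕ a)))
... | no p≢a with p Fin.≟ b
...   | yes refl = sym (trans (cong (swapAt (toℕ a)) b≡1+a) (swapAt-right (toℕ a)))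
...   | no p≢b = sym (swapAt-fixes (toℕ a) (toℕ p) (p≢a ∘ toℕ-injective)
                                   (p≢b ∘ toℕ-injective ∘ (λ p≡1+a → trans p≡1+a (sym b≡1+a))))

module HalfperiodGeometry {n : ℕ} .{{_ : NonZero n}} (H : Halfperiod n) where

  N : ℕ
  N = n C 2

  -- Positions are natural numbers; position i is meaningful only for i < n.
  position : ℕ → Fin n
  position i = i mod n

  toℕ-position : ∀ i → i < n → toℕ (position i) ≡ i
  toℕ-position i i<n = trans (toℕ-fromℕ< _) (m<n⇒m%n≡m i<n)

  position-toℕ : ∀ p → position (toℕ p) ≡ p
  position-toℕ p = toℕ-injective (toℕ-position (toℕ p) (toℕ<n p))

  rank : Fin n → ℕ
  rank e = toℕ (π H 0 ⟨$⟩ˡ e)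

  point : ℕ → ℕ → Fin n
  point j i = π H j ⟨$⟩ʳ position i

  rankAt : ℕ → ℕ → ℕ
  rankAt j i = rank (point j i)

  place : ℕ → Fin n → ℕ
  place j e = toℕ (π H j ⟨$⟩ˡ e)

  L : ℕ → ℕ
  L j = toℕ (lo H j)

  1+L<n : ∀ j → j < N → suc (L j) < n
  1+L<n j j<N = subst (_< n) (adj H j j<N) (toℕ<n (hi H j))

  L<n : ∀ j → j < N → L j < n
  L<n j j<N = <-trans (n<1+n _) (1+L<n j j<N)

  place-point : ∀ j i → i < n → place j (point j i) ≡ i
  place-point j i i<n = trans (cong toℕ (inverseˡ (π H j))) (toℕ-position i i<n)

  point-place : ∀ j e → point j (place j e) ≡ e
  point-place j e = trans (cong (π H j ⟨$⟩ʳ_) (position-toℕ _)) (inverseʳ (π H j))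

  point-step : ∀ j → j < N → ∀ i → i < n → point (suc j) i ≡ point j (swapAt (L j) i)
  point-step j j<N i i<n = trans (step H j j<N (position i)) (cong (π H j ⟨$⟩ʳ_) (toℕ-injective (begin
    toℕ (transpose (lo H j) (hi H j) ⟨$⟩ʳ position i)  ≡⟨ toℕ-transpose-adjacent _ _ _ (adj H j j<N) ⟩
    swapAt (L j) (toℕ (position i))                    ≡⟨ cong (swapAt (L j)) (toℕ-position i i<n) ⟩
    swapAt (L j) i                                     ≡⟨ toℕ-position _ (swapAt-< (L j) i n (1+L<n j j<N) i<n) ⟨
    toℕ (position (swapAt (L j) i))                    ∎)))
    where open ≡-Reasoning

  place-step : ∀ j → j < N → ∀ e → place (suc j) e ≡ swapAt (L j) (place j e)
  place-step j j<N e = begin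
    place (suc j) e                                    ≡⟨ cong (place (suc j)) point-swapped ⟨
    place (suc j) (point (suc j) (swapAt (L j) (place j e)))  ≡⟨ place-point (suc j) _ swapped<n ⟩
    swapAt (L j) (place j e)                           ∎
    where
    open ≡-Reasoning
    swapped<n : swapAt (L j) (place j e) < n
    swapped<n = swapAt-< (L j) _ n (1+L<n j j<N) (toℕ<n _)
    point-swapped : point (suc j) (swapAt (L j) (place j e)) ≡ e
    point-swapped = trans (point-step j j<N _ swapped<n)
                          (trans (cong (point j) (swapAt-involutive (L j) _)) (point-place j e))

  rankAt-initial : ∀ i → i < n → rankAt 0 i ≡ i
  rankAt-initial = place-point 0

  rankAt-final : ∀ i → i < n → rankAt N i ≡ n ∸ suc i
  rankAt-final i i<n = begin
    rank (π H N ⟨$⟩ʳ position i)               ≡⟨ cong rank (rev H (position i)) ⟩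
    rank (π H 0 ⟨$⟩ʳ Fin.opposite (position i)) ≡⟨ cong toℕ (inverseˡ (π H 0)) ⟩
    toℕ (Fin.opposite (position i))             ≡⟨ opposite-prop (position i) ⟩
    n ∸ suc (toℕ (position i))                  ≡⟨ cong (λ x → n ∸ suc x) (toℕ-position i i<n) ⟩
    n ∸ suc i                                   ∎
    where open ≡-Reasoning

  ascends : ∀ j → j < N → rankAt j (L j) < rankAt j (suc (L j))
  ascends = every-step-ascends initially-sorted finally-reversed
    where
    open AdjacentSorting rankAt L 1+L<n (λ j j<N i i<n → cong rank (point-step j j<N i i<n))
    initially-sorted : inversions (rankAt 0) n ≡ 0
    initially-sorted = inversions-increasing (rankAt 0) n (λ i j i<j j<n →
      subst₂ _<_ (sym (rankAt-initial i (<-trans i<j j<n))) (sym (rankAt-initial j j<n)) i<j)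
    finally-reversed : inversions (rankAt N) n ≡ N
    finally-reversed = inversions-decreasing (rankAt N) n (λ i j i<j j<n →
      subst₂ _<_ (sym (rankAt-final j j<n)) (sym (rankAt-final i (<-trans i<j j<n)))
             (∸-monoʳ-< (s<s i<j) j<n))

  stays-inverted : ∀ {x y} → rank x < rank y → ∀ {j} → place j y < place j x →
    ∀ j′ → j ≤ j′ → j′ ≤ N → place j′ y < place j′ x
  stays-inverted r y<x zero    j≤0 _ rewrite n≤0⇒n≡0 j≤0 = y<x
  stays-inverted {x} {y} r {j} y<x (suc j′) j≤1+j′ 1+j′≤N with m≤n⇒m<n∨m≡n j≤1+j′
  ... | inj₂ refl     = y<x
  ... | inj₁ j<1+j′ = subst₂ _<_ (sym (place-step j′ 1+j′≤N y)) (sym (place-step j′ 1+j′≤N x))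
    (swapAt-monotone (L j′) _ _ (stays-inverted r y<x j′ (s≤s⁻¹ j<1+j′) (<⇒≤ 1+j′≤N)) not-swapped)
    where
    not-swapped : ¬ (place j′ y ≡ L j′ × place j′ x ≡ suc (L j′))
    not-swapped (y-at-L , x-at-1+L) = <-asym r (subst₂ _<_
      (cong rank (trans (cong (point j′) (sym y-at-L)) (point-place j′ y)))
      (cong rank (trans (cong (point j′) (sym x-at-1+L)) (point-place j′ x)))
      (ascends j′ 1+j′≤N))

-- Three classes

/-reflects-< : ∀ {x y} d .{{_ : NonZero d}} → x / d < y / d → x < y
/-reflects-< d x/d<y/d with _ <? _
... | yes x<y = x<y
... | no x≮y  = contradiction (/-monoˡ-≤ d (≮⇒≥ x≮y)) (<⇒≱ x/d<y/d)

/≡ᵇ0 : ∀ i d .{{_ : NonZero d}} → (i / d ≡ᵇ 0) ≡ (i <ᵇ d)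
/≡ᵇ0 i d with i <? d
... | yes i<d = trans (dec-true (i / d ≟ 0) (m<n⇒m/n≡0 i<d)) (sym (dec-true (i <? d) i<d))
... | no i≮d  = trans (dec-false (i / d ≟ 0) (i≮d ∘ m/n≡0⇒m<n)) (sym (dec-false (i <? d) i≮d))

3d∸d≡2d : ∀ d → 3 * d ∸ d ≡ 2 * d
3d∸d≡2d d = trans (cong (_∸ d) (+-comm d (2 * d))) (m+n∸n≡m (2 * d) d)

[3d∸1+i]/d≡ᵇ2 : ∀ i d .{{_ : NonZero d}} → i < 3 * d → ((3 * d ∸ suc i) / d ≡ᵇ 2) ≡ (i <ᵇ d)
[3d∸1+i]/d≡ᵇ2 i d i<3d with i <? d
... | yes i<d = trans (dec-true (_ ≟ 2) (≤-antisym (s≤s⁻¹ (m<n*o⇒m/o<n x<3d)) 2≤x/d))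
                      (sym (dec-true (i <? d) i<d))
  where
  x<3d : 3 * d ∸ suc i < 3 * d
  x<3d = ∸-monoʳ-< {o = 0} z<s i<3d
  2≤x/d : 2 ≤ (3 * d ∸ suc i) / d
  2≤x/d = subst (_≤ (3 * d ∸ suc i) / d) (m*n/n≡m 2 d)
            (/-monoˡ-≤ d (subst (_≤ 3 * d ∸ suc i) (3d∸d≡2d d) (∸-monoʳ-≤ (3 * d) i<d)))
... | no i≮d = trans (dec-false (_ ≟ 2) (<⇒≢ (m<n*o⇒m/o<n x<2d))) (sym (dec-false (i <? d) i≮d))
  where
  x<2d : 3 * d ∸ suc i < 2 * d
  x<2d = subst (3 * d ∸ suc i <_) (3d∸d≡2d d)
               (∸-monoʳ-< (s≤s (≮⇒≥ i≮d)) i<3d)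

-- The block of positions holding class c (A = 0, B = 1, C = 2) when the order is B, C, A.
bcaBlock : ℕ → ℕ
bcaBlock 0 = 2
bcaBlock 1 = 0
bcaBlock _ = 1

leaving-first : ∀ x y → x ≤ y → y < 3 → ¬ (x ≡ 1 × y ≡ 2) →
  𝟙 (x ≡ᵇ 0) ≡ 𝟙 (y ≡ᵇ 0) + 𝟙 (not (x ≡ᵇ y))
leaving-first 0 0 _ _ _ = refl
leaving-first 0 1 _ _ _ = refl
leaving-first 0 2 _ _ _ = refl
leaving-first 1 1 _ _ _ = refl
leaving-first 1 2 _ _ ¬BC = contradiction (refl , refl) ¬BC
leaving-first 2 2 _ _ _ = refl
leaving-first (suc x) 0 () _ _
leaving-first (suc (suc x)) 1 (s≤s ()) _ _
leaving-first (suc (suc (suc x))) 2 (s≤s (s≤s ())) _ _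
leaving-first _ (suc (suc (suc y))) _ (s≤s (s≤s (s≤s ()))) _

entering-last : ∀ x y → x ≤ y → y < 3 → ¬ (x ≡ 0 × y ≡ 1) →
  𝟙 (y ≡ᵇ 2) ≡ 𝟙 (x ≡ᵇ 2) + 𝟙 (not (x ≡ᵇ y))
entering-last 0 0 _ _ _ = refl
entering-last 0 1 _ _ ¬AB = contradiction (refl , refl) ¬AB
entering-last 0 2 _ _ _ = refl
entering-last 1 1 _ _ _ = refl
entering-last 1 2 _ _ _ = refl
entering-last 2 2 _ _ _ = refl
entering-last (suc x) 0 () _ _
entering-last (suc (suc x)) 1 (s≤s ()) _ _
entering-last (suc (suc (suc x))) 2 (s≤s (s≤s ())) _ _
entering-last _ (suc (suc (suc y))) _ (s≤s (s≤s (s≤s ()))) _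

bcaBlock-partition : ∀ c → c < 3 → 𝟙 (c ≡ᵇ 0) + 𝟙 (c ≡ᵇ 2) + 𝟙 (bcaBlock c ≡ᵇ 0) ≡ 1
bcaBlock-partition 0 _ = refl
bcaBlock-partition 1 _ = refl
bcaBlock-partition 2 _ = refl
bcaBlock-partition (suc (suc (suc _))) (s≤s (s≤s (s≤s ())))

module ThreeClasses (m : ℕ) .{{_ : NonZero m}} (H : Halfperiod (3 * m)) where

  private instance
    3m≢0 : NonZero (3 * m)
    3m≢0 = m*n≢0 3 m

  open HalfperiodGeometry H public

  class : Fin (3 * m) → ℕ
  class = cls m H

  class<3 : ∀ e → class e < 3
  class<3 e = m<n*o⇒m/o<n (toℕ<n (π H 0 ⟨$⟩ˡ e))

  class-ascends : ∀ j → j < N → class (point j (L j)) ≤ class (point j (suc (L j)))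
  class-ascends j j<N = /-monoˡ-≤ m (<⇒≤ (ascends j j<N))

  bichromatic-points : ∀ j → j < N →
    bichromatic m H j ≡ not (class (point j (L j)) ≡ᵇ class (point j (suc (L j))))
  bichromatic-points j j<N = cong₂ (λ a b → not (class (π H j ⟨$⟩ʳ a) ≡ᵇ class (π H j ⟨$⟩ʳ b)))
    (sym (position-toℕ (lo H j)))
    (sym (trans (cong position (sym (adj H j j<N))) (position-toℕ (hi H j))))

  bcaBlock-class : ∀ σ → listsBCA m H σ → ∀ p → bcaBlock (class (σ ⟨$⟩ʳ p)) ≡ block m H p
  bcaBlock-class σ bca p with block m H p | bca p | m<n*o⇒m/o<n {n = 3} (toℕ<n p)
  ... | 0 | c≡1 | _ rewrite c≡1 = refl
  ... | 1 | c≡2 | _ rewrite c≡2 = refl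
  ... | 2 | c≡0 | _ rewrite c≡0 = refl
  ... | suc (suc (suc _)) | _ | s≤s (s≤s (s≤s ()))

  count : ℕ → ℕ → ℕ → ℕ
  count j c b = ∑[ i < suc b ] 𝟙 (class (point j i) ≡ᵇ c)

  count-step-away : ∀ j → j < N → ∀ c b → suc b < 3 * m → b ≢ L j → count (suc j) c b ≡ count j c b
  count-step-away j j<N c b 1+b<n b≢L = trans
    (∑-cong (suc b) (λ i i<1+b → cong (λ e → 𝟙 (class e ≡ᵇ c)) (point-step j j<N i (<-trans i<1+b 1+b<n))))
    (∑-swapAt (λ i → 𝟙 (class (point j i) ≡ᵇ c)) (L j) (suc b) (b≢L ∘ suc-injective))

  count-step-at : ∀ j → j < N → ∀ c →
    count (suc j) c (L j) + 𝟙 (class (point j (L j)) ≡ᵇ c)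
      ≡ count j c (L j) + 𝟙 (class (point j (suc (L j))) ≡ᵇ c)
  count-step-at j j<N c = trans
    (cong (_+ 𝟙 (class (point j (L j)) ≡ᵇ c)) (∑-cong (suc (L j)) (λ i i<1+L →
      cong (λ e → 𝟙 (class e ≡ᵇ c)) (point-step j j<N i (<-trans i<1+L (1+L<n j j<N))))))
    (∑-swapAt-adjacent (λ i → 𝟙 (class (point j i) ≡ᵇ c)) (L j))

  count-initial : ∀ b → suc b < 3 * m → count 0 0 b ≡ suc b ⊓ m
  count-initial b 1+b<n = trans (∑-cong (suc b) (λ i i<1+b →
    cong 𝟙 (trans (cong (λ r → r / m ≡ᵇ 0) (rankAt-initial i (<-trans i<1+b 1+b<n))) (/≡ᵇ0 i m))))
    (∑-<ᵇ m (suc b))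

  count-final : ∀ b → suc b < 3 * m → count N 2 b ≡ suc b ⊓ m
  count-final b 1+b<n = trans (∑-cong (suc b) (λ i i<1+b →
    cong 𝟙 (trans (cong (λ r → r / m ≡ᵇ 2) (rankAt-final i (<-trans i<1+b 1+b<n)))
                  ([3d∸1+i]/d≡ᵇ2 i m (<-trans i<1+b 1+b<n)))))
    (∑-<ᵇ m (suc b))

  module AfterBCA (t : ℕ) (1+t≤N : suc t ≤ N) (bca : listsBCA m H (π H (suc t))) where

    bcaBlock-place : ∀ e → bcaBlock (class e) ≡ place (suc t) e / m
    bcaBlock-place e = trans (cong (bcaBlock ∘ class) (sym (inverseʳ (π H (suc t)))))
                             (bcaBlock-class (π H (suc t)) bca (π H (suc t) ⟨$⟩ˡ e))

    precedes-at-BCA : ∀ {u v} → bcaBlock (class u) < bcaBlock (class v) → place (suc t) u < place (suc t) v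
    precedes-at-BCA u<v = /-reflects-< m (subst₂ _<_ (bcaBlock-place _) (bcaBlock-place _) u<v)

    no-BC-before : ∀ j → j < suc t → j < N →
      ¬ (class (point j (L j)) ≡ 1 × class (point j (suc (L j))) ≡ 2)
    no-BC-before j j≤t j<N (u∈B , v∈C) = <-asym (precedes-at-BCA B<C) C-before-B
      where
      u v : Fin (3 * m)
      u = point j (L j)
      v = point j (suc (L j))
      B<C : bcaBlock (class u) < bcaBlock (class v)
      B<C = subst₂ (λ x y → bcaBlock x < bcaBlock y) (sym u∈B) (sym v∈C) z<s
      swapped : place (suc j) v < place (suc j) u
      swapped = subst₂ _<_
        (sym (trans (place-step j j<N v) (trans (cong (swapAt (L j)) (place-point j _ (1+L<n j j<N))) (swapAt-right (L j)))))
        (sym (trans (place-step j j<N u) (trans (cong (swapAt (L j)) (place-point j _ (L<n j j<N))) (swapAt-left (L j)))))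
        (n<1+n (L j))
      C-before-B : place (suc t) v < place (suc t) u
      C-before-B = stays-inverted (ascends j j<N) swapped (suc t) j≤t 1+t≤N

    no-AB-after : ∀ j → suc t ≤ j → j < N →
      ¬ (class (point j (L j)) ≡ 0 × class (point j (suc (L j))) ≡ 1)
    no-AB-after j t<j j<N (u∈A , v∈B) = <-asym in-order (stays-inverted (ascends j j<N) B-before-A j t<j (<⇒≤ j<N))
      where
      u v : Fin (3 * m)
      u = point j (L j)
      v = point j (suc (L j))
      B-before-A : place (suc t) v < place (suc t) u
      B-before-A = precedes-at-BCA (subst₂ (λ x y → bcaBlock x < bcaBlock y) (sym v∈B) (sym u∈A) z<s)
      in-order : place j u < place j v
      in-order = subst₂ _<_ (sym (place-point j _ (L<n j j<N))) (sym (place-point j _ (1+L<n j j<N))) (n<1+n (L j))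

    first-class-leaves : ∀ j → j < suc t → j < N → count (suc j) 0 (L j) + 𝟙 (bichromatic m H j) ≡ count j 0 (L j)
    first-class-leaves j j≤t j<N = +-cancelʳ-≡ (𝟙 (y ≡ᵇ 0)) _ _ (begin
      after + 𝟙 (bichromatic m H j) + 𝟙 (y ≡ᵇ 0)  ≡⟨ xy∙z≈x∙zy after _ _ ⟩
      after + (𝟙 (y ≡ᵇ 0) + 𝟙 (bichromatic m H j))  ≡⟨ cong (λ b → after + (𝟙 (y ≡ᵇ 0) + 𝟙 b)) (bichromatic-points j j<N) ⟩
      after + (𝟙 (y ≡ᵇ 0) + 𝟙 (not (x ≡ᵇ y)))      ≡⟨ cong (after +_) x∈A-changes ⟨
      after + 𝟙 (x ≡ᵇ 0)                          ≡⟨ count-step-at j j<N 0 ⟩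
      count j 0 (L j) + 𝟙 (y ≡ᵇ 0)                ∎)
      where
      open ≡-Reasoning
      x y after : ℕ
      x = class (point j (L j))
      y = class (point j (suc (L j)))
      after = count (suc j) 0 (L j)
      x∈A-changes : 𝟙 (x ≡ᵇ 0) ≡ 𝟙 (y ≡ᵇ 0) + 𝟙 (not (x ≡ᵇ y))
      x∈A-changes = leaving-first x y (class-ascends j j<N) (class<3 _) (no-BC-before j j≤t j<N)

    last-class-enters : ∀ j → suc t ≤ j → j < N → count (suc j) 2 (L j) ≡ count j 2 (L j) + 𝟙 (bichromatic m H j)
    last-class-enters j t<j j<N = +-cancelʳ-≡ (𝟙 (x ≡ᵇ 2)) _ _ (begin
      count (suc j) 2 (L j) + 𝟙 (x ≡ᵇ 2)           ≡⟨ count-step-at j j<N 2 ⟩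
      before + 𝟙 (y ≡ᵇ 2)                          ≡⟨ cong (before +_) y∈C-changes ⟩
      before + (𝟙 (x ≡ᵇ 2) + 𝟙 (not (x ≡ᵇ y)))     ≡⟨ cong (λ b → before + (𝟙 (x ≡ᵇ 2) + 𝟙 b)) (bichromatic-points j j<N) ⟨
      before + (𝟙 (x ≡ᵇ 2) + 𝟙 (bichromatic m H j)) ≡⟨ xy∙z≈x∙zy before _ _ ⟨
      before + 𝟙 (bichromatic m H j) + 𝟙 (x ≡ᵇ 2)  ∎)
      where
      open ≡-Reasoning
      x y before : ℕ
      x = class (point j (L j))
      y = class (point j (suc (L j)))
      before = count j 2 (L j)
      y∈C-changes : 𝟙 (y ≡ᵇ 2) ≡ 𝟙 (x ≡ᵇ 2) + 𝟙 (not (x ≡ᵇ y))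
      y∈C-changes = entering-last x y (class-ascends j j<N) (class<3 _) (no-AB-after j t<j j<N)

    count-at-BCA : ∀ b → suc b < 3 * m → count (suc t) 0 b + count (suc t) 2 b + suc b ⊓ m ≡ suc b
    count-at-BCA b 1+b<n = begin
      ∑< (suc b) isA + ∑< (suc b) isC + suc b ⊓ m         ≡⟨ cong (∑< (suc b) isA + ∑< (suc b) isC +_) (∑-<ᵇ m (suc b)) ⟨
      ∑< (suc b) isA + ∑< (suc b) isC + ∑< (suc b) early  ≡⟨ cong (_+ ∑< (suc b) early) (∑-+ isA isC (suc b)) ⟨
      ∑[ i < suc b ] (isA i + isC i) + ∑< (suc b) early   ≡⟨ ∑-+ (λ i → isA i + isC i) early (suc b) ⟨
      ∑[ i < suc b ] (isA i + isC i + early i)            ≡⟨ ∑-cong (suc b) (λ i i<1+b → partition i (<-trans i<1+b 1+b<n)) ⟩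
      ∑[ _ < suc b ] 1                                    ≡⟨ ∑-const 1 (suc b) ⟩
      suc b * 1                                           ≡⟨ *-identityʳ (suc b) ⟩
      suc b                                               ∎
      where
      open ≡-Reasoning
      isA isC early : ℕ → ℕ
      isA i   = 𝟙 (class (point (suc t) i) ≡ᵇ 0)
      isC i   = 𝟙 (class (point (suc t) i) ≡ᵇ 2)
      early i = 𝟙 (i <ᵇ m)
      partition : ∀ i → i < 3 * m → isA i + isC i + early i ≡ 1
      partition i i<n = trans (cong (λ z → isA i + isC i + 𝟙 z) (begin
          i <ᵇ m                                    ≡⟨ /≡ᵇ0 i m ⟨
          i / m ≡ᵇ 0                                ≡⟨ cong (λ p → p / m ≡ᵇ 0) (place-point (suc t) i i<n) ⟨
          place (suc t) (point (suc t) i) / m ≡ᵇ 0  ≡⟨ cong (_≡ᵇ 0) (bcaBlock-place _) ⟨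
          bcaBlock (class (point (suc t) i)) ≡ᵇ 0   ∎))
        (bcaBlock-partition _ (class<3 _))

    module Critical (k : ℕ) where

      critical : ℕ → Bool
      critical = criticalGap (3 * m) k

      potential : ℕ → ℕ → ℕ
      potential c j = criticalSum (3 * m) k (count j c)

      counted : ℕ → ℕ
      counted j = 𝟙 (critical≤ m H k j ∧ bichromatic m H j)

      1+gap<n : ∀ b → b < pred (3 * m) → suc b < 3 * m
      1+gap<n b = m≤pred[n]⇒suc[m]≤n

      potential-step : ∀ c j → j < N → ∀ d e →
        gate (critical (L j)) (count (suc j) c (L j)) + d ≡ gate (critical (L j)) (count j c (L j)) + e →
        potential c (suc j) + d ≡ potential c j + e
      potential-step c j j<N d e = ∑-update _ _ (pred (3 * m)) (L j) d e (suc[m]≤n⇒m≤pred[n] (1+L<n j j<N))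
        (λ b b<n-1 b≢L → cong (gate (critical b)) (count-step-away j j<N c b (1+gap<n b b<n-1) b≢L))

      potential-first-step : ∀ j → j < suc t → j < N → potential 0 (suc j) + counted j ≡ potential 0 j
      potential-first-step j j≤t j<N = trans (potential-step 0 j j<N (counted j) 0 (begin
        gate w (count (suc j) 0 (L j)) + 𝟙 (w ∧ bi)  ≡⟨ gate-𝟙 w bi _ ⟩
        gate w (count (suc j) 0 (L j) + 𝟙 bi)        ≡⟨ cong (gate w) (first-class-leaves j j≤t j<N) ⟩
        gate w (count j 0 (L j))                     ≡⟨ +-identityʳ _ ⟨
        gate w (count j 0 (L j)) + 0                 ∎)) (+-identityʳ _)
        where
        open ≡-Reasoning
        w bi : Bool
        w  = critical (L j)
        bi = bichromatic m H j

      potential-last-step : ∀ j → suc t ≤ j → j < N → potential 2 (suc j) ≡ potential 2 j + counted j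
      potential-last-step j t<j j<N = trans (sym (+-identityʳ _)) (potential-step 2 j j<N 0 (counted j) (begin
        gate w (count (suc j) 2 (L j)) + 0           ≡⟨ +-identityʳ _ ⟩
        gate w (count (suc j) 2 (L j))               ≡⟨ cong (gate w) (last-class-enters j t<j j<N) ⟩
        gate w (count j 2 (L j) + 𝟙 bi)              ≡⟨ gate-𝟙 w bi _ ⟨
        gate w (count j 2 (L j)) + 𝟙 (w ∧ bi)        ∎))
        where
        open ≡-Reasoning
        w bi : Bool
        w  = critical (L j)
        bi = bichromatic m H j

      Nbi≤+criticalSum-suc : Nbi≤ m H k + criticalSum (3 * m) k suc ≡ 3 * criticalSum (3 * m) k (λ b → suc b ⊓ m)
      Nbi≤+criticalSum-suc = telescope-halves {a = potential 0 (suc t)} {c = potential 2 (suc t)}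
                               split first-half second-half at-BCA
        where
        d : ℕ
        d = N ∸ suc t
        1+t+d≡N : suc t + d ≡ N
        1+t+d≡N = m+[n∸m]≡n 1+t≤N
        split : Nbi≤ m H k ≡ ∑< (suc t) counted + ∑[ j < d ] counted (suc t + j)
        split = trans (sum-applyUpTo _ (λ j → j) N)
                      (trans (cong (λ n → ∑< n counted) (sym 1+t+d≡N)) (∑-split counted (suc t) d))
        first-half : ∑< (suc t) counted + potential 0 (suc t) ≡ criticalSum (3 * m) k (λ b → suc b ⊓ m)
        first-half = trans
          (telescope-down (potential 0) counted (suc t) (λ j j≤t → potential-first-step j j≤t (<-≤-trans j≤t 1+t≤N)))
          (∑-cong (pred (3 * m)) (λ b b<n-1 → cong (gate (critical b)) (count-initial b (1+gap<n b b<n-1))))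
        second-half : potential 2 (suc t) + ∑[ j < d ] counted (suc t + j) ≡ criticalSum (3 * m) k (λ b → suc b ⊓ m)
        second-half = trans
          (telescope-up (potential 2) counted (suc t) d (λ j j<d → potential-last-step (suc t + j) (m≤m+n _ _)
             (subst (suc t + j <_) 1+t+d≡N (+-monoʳ-< (suc t) j<d))))
          (trans (cong (potential 2) 1+t+d≡N)
                 (∑-cong (pred (3 * m)) (λ b b<n-1 → cong (gate (critical b)) (count-final b (1+gap<n b b<n-1)))))
        at-BCA : potential 0 (suc t) + potential 2 (suc t) + criticalSum (3 * m) k (λ b → suc b ⊓ m)
                 ≡ criticalSum (3 * m) k suc
        at-BCA = trans (cong (_+ _) (sym (∑-+ _ _ (pred (3 * m))))) (trans (sym (∑-+ _ _ (pred (3 * m))))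
          (∑-cong (pred (3 * m)) (λ b b<n-1 →
            trans (cong (_+ _) (gate-+ (critical b) _ _))
                  (trans (gate-+ (critical b) _ _) (cong (gate (critical b)) (count-at-BCA b (1+gap<n b b<n-1)))))))

Nbi≤≡3*∑⊓ : ∀ m .{{_ : NonZero m}} (H : Halfperiod (3 * m)) → ThreeDecomposable m H →
  ∀ k → 2 * k < 3 * m → Nbi≤ m H k ≡ 3 * ∑[ b < k ] (suc b ⊓ m)
Nbi≤≡3*∑⊓ m H (_ , t , _ , _ , _ , 1+t≤N , _ , bca) k 2k<3m = +-cancelʳ-≡ (k * (3 * m)) _ _ (begin
  Nbi≤ m H k + k * (3 * m)                               ≡⟨ cong (Nbi≤ m H k +_) suc-sum ⟨
  Nbi≤ m H k + criticalSum (3 * m) k suc                 ≡⟨ Nbi≤+criticalSum-suc ⟩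
  3 * criticalSum (3 * m) k (λ b → suc b ⊓ m)            ≡⟨ cong (3 *_) ⊓-sum ⟩
  3 * (∑[ b < k ] (suc b ⊓ m) + k * m)                   ≡⟨ 3*[a+d*m]≡3*a+d*[3*m] (∑[ b < k ] (suc b ⊓ m)) k m ⟩
  3 * ∑[ b < k ] (suc b ⊓ m) + k * (3 * m)               ∎)
  where
  open ≡-Reasoning
  open ThreeClasses m H using (module AfterBCA)
  open AfterBCA t 1+t≤N bca using (module Critical)
  open Critical k using (Nbi≤+criticalSum-suc)
  r : ℕ
  r = proj₁ (gaps-decomposition (3 * m) k 2k<3m)
  3m≡ : 3 * m ≡ suc (k + (r + k))
  3m≡ = proj₂ (gaps-decomposition (3 * m) k 2k<3m)
  suc-sum : criticalSum (3 * m) k suc ≡ k * (3 * m)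
  suc-sum = trans (cong (λ n → criticalSum n k suc) 3m≡) (trans (criticalSum-suc k r) (cong (k *_) (sym 3m≡)))
  ⊓-sum : criticalSum (3 * m) k (λ b → suc b ⊓ m) ≡ ∑[ b < k ] (suc b ⊓ m) + k * m
  ⊓-sum = trans (cong (λ n → criticalSum n k (λ b → suc b ⊓ m)) 3m≡)
                (criticalSum-⊓ k r m (3m≡gaps⇒m≤1+k+r m k r 3m≡ 2k<3m))

proposition1 : (m : ℕ) .{{_ : NonZero m}} (H : Halfperiod (3 * m)) →
    ThreeDecomposable m H → (k : ℕ) → 1 ≤ k → 2 * k < 3 * m →
    (k ≤ m → Nbi≤ m H k ≡ 3 * (suc k C 2))
    × (m < k → Nbi≤ m H k ≡ 3 * (suc m C 2) + (k ∸ m) * (3 * m))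
proposition1 m H decomposable k _ 2k<3m =
  (λ k≤m → trans formula (cong (3 *_) (∑-⊓-below m k k≤m))) ,
  (λ m<k → trans formula (trans (cong (3 *_) (∑-⊓-above m k (<⇒≤ m<k)))
                                (3*[a+d*m]≡3*a+d*[3*m] (suc m C 2) (k ∸ m) m)))
  where
  formula : Nbi≤ m H k ≡ 3 * ∑[ b < k ] (suc b ⊓ m)
  formula = Nbi≤≡3*∑⊓ m H decomposable k 2k<3m
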